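{- Let $r\ge 2$ be an integer. There exists an $r$-BG graph $G$ with at least $r+1$ vertices which has a cut set of size less than $r$ and which contains at least $r(r-1)$ $r$-blocks. In other words, the maximum number of $r$-blocks in an $r$-BG graph with at least $r+1$ vertices having a cut set of size less than $r$ is at least $r(r-1)$.
   Context: Bootstrap percolation with threshold $r$ on a finite simple graph $G$: starting from an initially infected set $A_0\subseteq V(G)$, define $A_t=A_{t-1}\cup\{v\in V(G): |N(v)\cap A_{t-1}|\ge r\}$ for $t\ge1$; $A_0$ percolates if eventually every vertex is infected. $G$ is $r$-bootstrap good ($r$-BG) if it contains a set of $r$ vertices which percolates with threshold $r$. A cut set is a set $X\subseteq V(G)$ with $G-X$ disconnected. A graph is $k$-connected if it has at least $k+1$ vertices and no cut set of size less than $k$. An $r$-block of $G$ is a maximal (under inclusion) induced $r$-connected subgraph of $G$ that is not contained in any induced $(r+1)$-connected subgraph of $G$. -}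

module Defs where

open import Data.Nat using (ℕ; zero; suc; _+_; _*_; _∸_; _≤_; _<_; _≤ᵇ_)
open import Data.Bool using (Bool; true; false; _∨_; T)
open import Data.Fin using (Fin)
open import Data.Fin.Subset using (Subset; _∈_; _∉_; _⊆_; _∩_; _─_; ∣_∣; ⊤)
open import Data.Vec using (tabulate; lookup)
open import Data.Product using (Σ; ∃; _×_; _,_)
open import Function.Definitions using (Injective)
open import Relation.Binary.PropositionalEquality using (_≡_)
open import Relation.Nullary using (¬_)

record Graph : Set where
  field
    n     : ℕ
    adj   : Fin n → Fin n → Bool
    sym   : ∀ u v → adj u v ≡ adj v u
    irref : ∀ v → adj v v ≡ false

open Graph public

module _ (G : Graph) where

  N : Fin (n G) → Subset (n G)
  N v = tabulate (adj G v)

  step : ℕ → Subset (n G) → Subset (n G)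
  step r A = tabulate λ v → lookup A v ∨ (r ≤ᵇ ∣ N v ∩ A ∣)

  infected : ℕ → Subset (n G) → ℕ → Subset (n G)
  infected r A zero    = A
  infected r A (suc t) = step r (infected r A t)

  Percolates : ℕ → Subset (n G) → Set
  Percolates r A = ∃ λ t → infected r A t ≡ ⊤

  BG : ℕ → Set
  BG r = ∃ λ (A : Subset (n G)) → ∣ A ∣ ≡ r × Percolates r A

  data Reach (S : Subset (n G)) : Fin (n G) → Fin (n G) → Set where
    here : ∀ {u} → u ∈ S → Reach S u u
    next : ∀ {u v w} → u ∈ S → T (adj G u v) → Reach S v w → Reach S u w

  Disconnected : Subset (n G) → Set
  Disconnected S = ∃ λ u → ∃ λ v → u ∈ S × v ∈ S × ¬ Reach S u v

  CutSetIn : Subset (n G) → Subset (n G) → Set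
  CutSetIn S X = X ⊆ S × Disconnected (S ─ X)

  KConnected : ℕ → Subset (n G) → Set
  KConnected k S =
    suc k ≤ ∣ S ∣ × (∀ X → CutSetIn S X → ¬ (∣ X ∣ < k))

  IsBlock : ℕ → Subset (n G) → Set
  IsBlock r S =
    KConnected r S
    × (∀ S' → S ⊆ S' → KConnected r S' → S' ≡ S)
    × (∀ S' → S ⊆ S' → ¬ KConnected (suc r) S')

  HasSmallCut : ℕ → Set
  HasSmallCut r = ∃ λ X → CutSetIn ⊤ X × ∣ X ∣ < r

  AtLeastBlocks : ℕ → ℕ → Set
  AtLeastBlocks r m =
    Σ (Fin m → Subset (n G)) λ f → Injective _≡_ _≡_ f × (∀ i → IsBlock r (f i))

-- Write m = r - 1. The graph has m hubs (hub l) and r copies; copy i is a clique C_i of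
-- m inner vertices (inner i j) together with m outer vertices (outer i l), where outer i l
-- is adjacent to all of C_i and to hub l, and every hub is adjacent to every inner vertex.
-- The m hubs separate the copies. For each i and l, C_i ∪ {hub l, outer i l} is a clique on
-- r + 1 vertices, hence r-connected, and it is a maximal r-connected set: a larger
-- r-connected set either leaves copy i and the hubs, and then the m < r hubs separate it,
-- or it stays there, and then C_i separates {hub l, outer i l} from the remaining
-- vertices. This gives r (r - 1) r-blocks. Seeding inner i 0 for every i infects the hubs,
-- then every inner vertex, then every outer vertex, so these r vertices percolate.

module Submission where

open import Defs hiding (sym)
open import Data.Nat using (ℕ; zero; suc; _+_; _*_; _∸_; _≤_; _<_; z≤n; s≤s)
open import Data.Nat.Properties
  using (≤-trans; ≤-<-trans; ≤-antisym; ≤-reflexive; ≤⇒≯; n≤1+n; m<n⇒m<1+n; ≤⇒≤ᵇ)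
open import Data.Bool using (Bool; true; false; _∨_; _∧_; not; T)
open import Data.Bool.Properties using (T-≡; T-∨; T-∧)
open import Data.Empty using (⊥-elim)
open import Data.Fin using (Fin; zero; suc; _≟_)
open import Data.Fin.Patterns using (0F; 1F)
open import Data.Fin.Properties using (+↔⊎; *↔×; suc-injective; 0≢1+n; ¬Fin0)
open import Data.Fin.Subset
  using (Subset; inside; outside; _∈_; _∉_; _⊆_; _∩_; _─_; _-_; ∣_∣; ⊤)
open import Data.Fin.Subset.Properties
  using ( ∈⊤; ⊆⊤; ⊆-antisym; p∩q⊆p; ∣p∩q∣≤∣q∣; x∈p∩q⁺; p─q⊆p; x∈p∧x∉q⇒x∈p─q; x∈p∧x≢y⇒x∈p-y
        ; x∈p⇒∣p-x∣<∣p∣; p─⊥≡p; x∈⁅x⁆; Empty-unique; ∣⊥∣≡0; ∣p∣≤n)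
open import Data.Product using (Σ; ∃; _×_; _,_; proj₁; uncurry)
open import Data.Sum using (_⊎_; inj₁; inj₂)
open import Data.Sum.Function.Propositional using (_⊎-↔_)
open import Data.Vec using (tabulate)
open import Data.Vec.Properties using (lookup∘tabulate; []=⇒lookup; lookup⇒[]=)
open import Function.Base using (_∘_)
open import Function.Bundles using (_↔_; Inverse; Injection; Equivalence; mk↔ₛ′)
open import Function.Definitions using (Injective)
open import Function.Properties.Inverse using (↔-refl; ↔-sym; ↔-trans; ↔⇒↣)
open import Relation.Binary.PropositionalEquality
  using (_≡_; _≢_; refl; sym; trans; cong; subst)
open import Relation.Nullary using (¬_; yes; no; contradiction)
open import Relation.Nullary.Decidable using (T?; ⌊_⌋; toWitness; fromWitness; fromWitnessFalse)

private variable d k : ℕ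

module _ where
  open import Data.Vec using ([]; _∷_; here; there)

  ∈-tabulate⁺ : ∀ {f : Fin d → Bool} {x} → T (f x) → x ∈ tabulate f
  ∈-tabulate⁺ {f = f} {x} t =
    lookup⇒[]= x (tabulate f) (trans (lookup∘tabulate f x) (Equivalence.to T-≡ t))

  ∈-tabulate⁻ : ∀ {f : Fin d → Bool} {x} → x ∈ tabulate f → T (f x)
  ∈-tabulate⁻ {f = f} {x} x∈ =
    Equivalence.from T-≡ (trans (sym (lookup∘tabulate f x)) ([]=⇒lookup x∈))

  x∈p─q⇒x∉q : ∀ {p q : Subset d} {x} → x ∈ p ─ q → x ∉ q
  x∈p─q⇒x∉q {p = _ ∷ _} {_ ∷ _} (there x∈) (there x∈q) = x∈p─q⇒x∉q x∈ x∈q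
  x∈p─q⇒x∉q {p = _ ∷ _} {_ ∷ _} () here

  p─p∩q≡p─q : ∀ (p q : Subset d) → p ─ (p ∩ q) ≡ p ─ q
  p─p∩q≡p─q []            []            = refl
  p─p∩q≡p─q (inside ∷ p)  (inside ∷ q)  = cong (_ ∷_) (p─p∩q≡p─q p q)
  p─p∩q≡p─q (inside ∷ p)  (outside ∷ q) = cong (_ ∷_) (p─p∩q≡p─q p q)
  p─p∩q≡p─q (outside ∷ p) (inside ∷ q)  = cong (_ ∷_) (p─p∩q≡p─q p q)
  p─p∩q≡p─q (outside ∷ p) (outside ∷ q) = cong (_ ∷_) (p─p∩q≡p─q p q)

  ∣p∣≤1+∣p-x∣ : ∀ (p : Subset d) x → ∣ p ∣ ≤ suc ∣ p - x ∣
  ∣p∣≤1+∣p-x∣ (inside ∷ p)  zero    = ≤-reflexive (cong (suc ∘ ∣_∣) (sym (p─⊥≡p p)))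
  ∣p∣≤1+∣p-x∣ (outside ∷ p) zero    = ≤-trans (≤-reflexive (cong ∣_∣ (sym (p─⊥≡p p)))) (n≤1+n _)
  ∣p∣≤1+∣p-x∣ (inside ∷ p)  (suc x) = s≤s (∣p∣≤1+∣p-x∣ p x)
  ∣p∣≤1+∣p-x∣ (outside ∷ p) (suc x) = ∣p∣≤1+∣p-x∣ p x

¬T-∨ : ∀ {x y} → ¬ T (x ∨ y) → ¬ T x × ¬ T y
¬T-∨ ¬x∨y = ¬x∨y ∘ Equivalence.from T-∨ ∘ inj₁ , ¬x∨y ∘ Equivalence.from T-∨ ∘ inj₂

_==_ : Fin d → Fin d → Bool
a == b = ⌊ a ≟ b ⌋

==⇒≡ : ∀ (a b : Fin d) → T (a == b) → a ≡ b
==⇒≡ a b = toWitness {a? = a ≟ b}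

≡⇒== : ∀ {a b : Fin d} → a ≡ b → T (a == b)
≡⇒== {a = a} {b} = fromWitness {a? = a ≟ b}

==-refl : ∀ (a : Fin d) → (a == a) ≡ true
==-refl a = Equivalence.to T-≡ (≡⇒== refl)

==-sym : ∀ (a b : Fin d) → (a == b) ≡ (b == a)
==-sym a b with a ≟ b | b ≟ a
... | yes _   | yes _   = refl
... | no _    | no _    = refl
... | yes a≡b | no b≢a  = contradiction (sym a≡b) b≢a
... | no a≢b  | yes b≡a = contradiction (sym b≡a) a≢b

module _ where
  open import Data.Vec.Functional using (_∷_)

  Injective-∷ : ∀ {A : Set} {a : A} {g : Fin k → A} →
                Injective _≡_ _≡_ g → (∀ i → g i ≢ a) → Injective _≡_ _≡_ (a ∷ g)
  Injective-∷ g-inj g≢a {zero}  {zero}  _  = refl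
  Injective-∷ g-inj g≢a {zero}  {suc j} eq = contradiction (sym eq) (g≢a j)
  Injective-∷ g-inj g≢a {suc i} {zero}  eq = contradiction eq (g≢a i)
  Injective-∷ g-inj g≢a {suc i} {suc j} eq = cong suc (g-inj eq)

injection⇒≤∣p∣ : ∀ {p : Subset d} (f : Fin k → Fin d) →
                 Injective _≡_ _≡_ f → (∀ i → f i ∈ p) → k ≤ ∣ p ∣
injection⇒≤∣p∣ {k = zero}  f f-inj f∈p = z≤n
injection⇒≤∣p∣ {k = suc k} f f-inj f∈p =
  ≤-trans (s≤s (injection⇒≤∣p∣ (f ∘ suc) (suc-injective ∘ f-inj) f∘suc∈p-f0))
          (x∈p⇒∣p-x∣<∣p∣ (f∈p zero))
  where
  f∘suc∈p-f0 : ∀ i → f (suc i) ∈ _ - f zero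
  f∘suc∈p-f0 i = x∈p∧x≢y⇒x∈p-y (f∈p (suc i)) (λ e → 0≢1+n (sym (f-inj e)))

covering⇒∣p∣≤ : ∀ {p : Subset d} (g : Fin k → Fin d) →
                (∀ {x} → x ∈ p → ∃ λ i → g i ≡ x) → ∣ p ∣ ≤ k
covering⇒∣p∣≤ {d} {k = zero} {p} g cover
  rewrite Empty-unique {p = p} (λ (_ , x∈p) → ¬Fin0 (proj₁ (cover x∈p))) =
  ≤-reflexive (∣⊥∣≡0 d)
covering⇒∣p∣≤ {k = suc k} {p} g cover =
  ≤-trans (∣p∣≤1+∣p-x∣ p (g zero)) (s≤s (covering⇒∣p∣≤ (g ∘ suc) cover-rest))
  where
  cover-rest : ∀ {x} → x ∈ p - g zero → ∃ λ i → g (suc i) ≡ x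
  cover-rest x∈ with cover (p─q⊆p _ _ x∈)
  ... | suc i , gi≡x = i , gi≡x
  ... | zero  , refl = contradiction (x∈⁅x⁆ (g zero)) (x∈p─q⇒x∉q x∈)

module _ (G : Graph) where

  Closed : Subset (n G) → Subset (n G) → Set
  Closed S Q = ∀ {w w'} → w ∈ Q → T (adj G w w') → w' ∈ S → w' ∈ Q

  Separated : Subset (n G) → Fin (n G) → Fin (n G) → Set
  Separated S u v = ∃ λ Q → Closed S Q × u ∈ Q × v ∉ Q

  Clique : Subset (n G) → Set
  Clique S = ∀ {u v} → u ∈ S → v ∈ S → u ≢ v → T (adj G u v)

  Reach-head : ∀ {S u v} → Reach G S u v → u ∈ S
  Reach-head (here u∈S)     = u∈S
  Reach-head (next u∈S _ _) = u∈S

  Reach-closed : ∀ {S Q u v} → Closed S Q → Reach G S u v → u ∈ Q → v ∈ Q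
  Reach-closed closed (here _)         u∈Q = u∈Q
  Reach-closed closed (next _ uv ρ) u∈Q = Reach-closed closed ρ (closed u∈Q uv (Reach-head ρ))

  Separated⇒Disconnected : ∀ {S u v} → u ∈ S → v ∈ S → Separated S u v → Disconnected G S
  Separated⇒Disconnected u∈S v∈S (Q , closed , u∈Q , v∉Q) =
    _ , _ , u∈S , v∈S , λ ρ → v∉Q (Reach-closed closed ρ u∈Q)

  -- The cut set is S ∩ Y rather than Y, since a cut set must lie inside S.
  KConnected⇒¬Separated : ∀ {k S Y u v} → KConnected G k S → ∣ Y ∣ < k →
                          u ∈ S ─ Y → v ∈ S ─ Y → ¬ Separated (S ─ Y) u v
  KConnected⇒¬Separated {S = S} {Y} (_ , no-small-cut) ∣Y∣<k u∈ v∈ sep =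
    no-small-cut (S ∩ Y) (p∩q⊆p S Y , disconnected) (≤-<-trans (∣p∩q∣≤∣q∣ S Y) ∣Y∣<k)
    where
    disconnected : Disconnected G (S ─ (S ∩ Y))
    disconnected rewrite p─p∩q≡p─q S Y = Separated⇒Disconnected u∈ v∈ sep

  Clique-⊆ : ∀ {S S'} → S' ⊆ S → Clique S → Clique S'
  Clique-⊆ S'⊆S clique u∈ v∈ = clique (S'⊆S u∈) (S'⊆S v∈)

  Clique⇒Reach : ∀ {S u v} → Clique S → u ∈ S → v ∈ S → Reach G S u v
  Clique⇒Reach {u = u} {v} clique u∈ v∈ with u ≟ v
  ... | yes refl = here u∈
  ... | no u≢v   = next u∈ (clique u∈ v∈ u≢v) (here v∈)

  Clique⇒KConnected : ∀ {k S} → Clique S → suc k ≤ ∣ S ∣ → KConnected G k S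
  Clique⇒KConnected {S = S} clique size = size , no-cut
    where
    no-cut : ∀ X → CutSetIn G S X → ¬ (∣ X ∣ < _)
    no-cut X (_ , _ , _ , u∈ , v∈ , ¬ρ) _ =
      ¬ρ (Clique⇒Reach (Clique-⊆ (p─q⊆p S X) clique) u∈ v∈)

  KConnected-weaken : ∀ {k S} → KConnected G (suc k) S → KConnected G k S
  KConnected-weaken (size , no-small-cut) =
    ≤-trans (n≤1+n _) size , λ X cut ∣X∣<k → no-small-cut X cut (m<n⇒m<1+n ∣X∣<k)

  maximal⇒IsBlock : ∀ {r S} → KConnected G r S → ∣ S ∣ ≤ suc r →
                    (∀ S' → S ⊆ S' → KConnected G r S' → S' ⊆ S) → IsBlock G r S
  maximal⇒IsBlock {r} {S} κ ∣S∣≤1+r maximal = κ , equal , not-larger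
    where
    equal : ∀ S' → S ⊆ S' → KConnected G r S' → S' ≡ S
    equal S' S⊆S' κ' = ⊆-antisym (maximal S' S⊆S' κ') S⊆S'

    not-larger : ∀ S' → S ⊆ S' → ¬ KConnected G (suc r) S'
    not-larger S' S⊆S' κ'@(2+r≤∣S'∣ , _) =
      ≤⇒≯ ∣S∣≤1+r
        (subst (λ X → suc (suc r) ≤ ∣ X ∣) (equal S' S⊆S' (KConnected-weaken κ')) 2+r≤∣S'∣)

  step-⊇ : ∀ {r A} → A ⊆ step G r A
  step-⊇ {A = A} x∈A =
    ∈-tabulate⁺ (Equivalence.from T-∨ (inj₁ (Equivalence.from T-≡ ([]=⇒lookup x∈A))))

  infected-+ : ∀ {r A} s t → infected G r A t ⊆ infected G r A (s + t)
  infected-+ zero    t x∈ = x∈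
  infected-+ {r} (suc s) t x∈ = step-⊇ {r} (infected-+ s t x∈)

  threshold⇒∈step : ∀ {r A v} (f : Fin r → Fin (n G)) → Injective _≡_ _≡_ f →
                    (∀ i → T (adj G v (f i))) → (∀ i → f i ∈ A) → v ∈ step G r A
  threshold⇒∈step {r} {A} {v} f f-inj adjacent infected-nbr =
    ∈-tabulate⁺ (Equivalence.from T-∨ (inj₂ (≤⇒≤ᵇ r≤∣N∩A∣)))
    where
    r≤∣N∩A∣ : r ≤ ∣ N G v ∩ A ∣
    r≤∣N∩A∣ = injection⇒≤∣p∣ f f-inj (λ i → x∈p∩q⁺ (∈-tabulate⁺ (adjacent i) , infected-nbr i))

  all-infected⇒Percolates : ∀ {r A} t → (∀ v → v ∈ infected G r A t) → Percolates G r A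
  all-infected⇒Percolates t all = t , ⊆-antisym ⊆⊤ (λ {v} _ → all v)

-- Graphs on a type V in bijection with the vertex set Fin d; ⟦ P ⟧ is the vertex set
-- cut out by a Boolean predicate on V.
module GraphOn {V : Set} (vertex : Fin d ↔ V) (_∼_ : V → V → Bool)
               (∼-sym : ∀ a b → a ∼ b ≡ b ∼ a) (∼-irrefl : ∀ a → a ∼ a ≡ false) where

  open Inverse vertex using (to; from; strictlyInverseˡ; strictlyInverseʳ)

  graph : Graph
  graph = record
    { n = d ; adj = λ u v → to u ∼ to v ; sym = λ u v → ∼-sym (to u) (to v) ; irref = ∼-irrefl ∘ to }

  ⟦_⟧ : (V → Bool) → Subset d
  ⟦ P ⟧ = tabulate (P ∘ to)

  to-injective : Injective _≡_ _≡_ to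
  to-injective = Injection.injective (↔⇒↣ vertex)

  from-injective : Injective _≡_ _≡_ from
  from-injective = Injection.injective (↔⇒↣ (↔-sym vertex))

  ∀-from : ∀ {Q : Fin d → Set} → (∀ a → Q (from a)) → ∀ u → Q u
  ∀-from {Q} h u = subst Q (strictlyInverseʳ u) (h (to u))

  ∈⟦⟧ : ∀ P {u} → T (P (to u)) → u ∈ ⟦ P ⟧
  ∈⟦⟧ P = ∈-tabulate⁺

  ∉⟦⟧ : ∀ P {u} → ¬ T (P (to u)) → u ∉ ⟦ P ⟧
  ∉⟦⟧ P ¬t u∈ = ¬t (∈-tabulate⁻ u∈)

  from-∈⟦⟧ : ∀ P a → T (P a) → from a ∈ ⟦ P ⟧
  from-∈⟦⟧ P a t = ∈⟦⟧ P (subst (T ∘ P) (sym (strictlyInverseˡ a)) t)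

  from-∈⟦⟧⁻ : ∀ P a → from a ∈ ⟦ P ⟧ → T (P a)
  from-∈⟦⟧⁻ P a a∈ = subst (T ∘ P) (strictlyInverseˡ a) (∈-tabulate⁻ a∈)

  from-∉⟦⟧ : ∀ P a → ¬ T (P a) → from a ∉ ⟦ P ⟧
  from-∉⟦⟧ P a ¬t = ¬t ∘ from-∈⟦⟧⁻ P a

  adj-from : ∀ a b → adj graph (from a) (from b) ≡ a ∼ b
  adj-from a b rewrite strictlyInverseˡ a | strictlyInverseˡ b = refl

  ≤∣⟦⟧∣ : ∀ P (f : Fin k → V) → Injective _≡_ _≡_ f → (∀ i → T (P (f i))) → k ≤ ∣ ⟦ P ⟧ ∣
  ≤∣⟦⟧∣ P f f-inj Pf =
    injection⇒≤∣p∣ (from ∘ f) (f-inj ∘ from-injective) (λ i → from-∈⟦⟧ P (f i) (Pf i))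

  ∣⟦⟧∣≤ : ∀ P (f : Fin k → V) → (∀ {a} → T (P a) → ∃ λ i → f i ≡ a) → ∣ ⟦ P ⟧ ∣ ≤ k
  ∣⟦⟧∣≤ P f cover = covering⇒∣p∣≤ (from ∘ f) λ {u} u∈ →
    let i , fi≡u = cover (∈-tabulate⁻ u∈) in i , trans (cong from fi≡u) (strictlyInverseʳ u)

  ⟦⟧-Separated : ∀ {S u v} R P →
                 (∀ w w' → T (P (to w)) → T (to w ∼ to w') → w' ∈ S → ¬ T (R (to w')) → T (P (to w'))) →
                 u ∈ ⟦ P ⟧ → v ∉ ⟦ P ⟧ → Separated graph (S ─ ⟦ R ⟧) u v
  ⟦⟧-Separated R P closed u∈ v∉ = ⟦ P ⟧ , closed⟦P⟧ , u∈ , v∉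
    where
    closed⟦P⟧ : Closed graph (_ ─ ⟦ R ⟧) ⟦ P ⟧
    closed⟦P⟧ {w} {w'} w∈ ww' w'∈ =
      ∈⟦⟧ P (closed w w' (∈-tabulate⁻ w∈) ww' (p─q⊆p _ _ w'∈) (x∈p─q⇒x∉q w'∈ ∘ ∈⟦⟧ R))

  ⟦⟧-Clique : ∀ {P} → (∀ {a b} → T (P a) → T (P b) → a ≢ b → T (a ∼ b)) → Clique graph ⟦ P ⟧
  ⟦⟧-Clique clique u∈ v∈ u≢v = clique (∈-tabulate⁻ u∈) (∈-tabulate⁻ v∈) (u≢v ∘ to-injective)

  from-∈step : ∀ {r A} a (f : Fin r → V) → Injective _≡_ _≡_ f →
               (∀ i → T (a ∼ f i)) → (∀ i → from (f i) ∈ A) → from a ∈ step graph r A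
  from-∈step a f f-inj adjacent =
    threshold⇒∈step graph (from ∘ f) (f-inj ∘ from-injective)
      (λ i → subst T (sym (adj-from a (f i))) (adjacent i))

module Construction (k : ℕ) where
  open import Data.Vec.Functional using (_∷_)

  m r : ℕ
  m = suc k
  r = suc m

  data Vertex : Set where
    hub   : Fin m → Vertex
    inner : Fin r → Fin m → Vertex
    outer : Fin r → Fin m → Vertex

  ⊎↔Vertex : (Fin m ⊎ (Fin r × Fin m) ⊎ (Fin r × Fin m)) ↔ Vertex
  ⊎↔Vertex = mk↔ₛ′ join split join∘split split∘join
    where
    join : Fin m ⊎ (Fin r × Fin m) ⊎ (Fin r × Fin m) → Vertex
    join (inj₁ l)              = hub l
    join (inj₂ (inj₁ (i , j))) = inner i j
    join (inj₂ (inj₂ (i , l))) = outer i l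

    split : Vertex → Fin m ⊎ (Fin r × Fin m) ⊎ (Fin r × Fin m)
    split (hub l)     = inj₁ l
    split (inner i j) = inj₂ (inj₁ (i , j))
    split (outer i l) = inj₂ (inj₂ (i , l))

    join∘split : ∀ a → join (split a) ≡ a
    join∘split (hub _)     = refl
    join∘split (inner _ _) = refl
    join∘split (outer _ _) = refl

    split∘join : ∀ s → split (join s) ≡ s
    split∘join (inj₁ _)        = refl
    split∘join (inj₂ (inj₁ _)) = refl
    split∘join (inj₂ (inj₂ _)) = refl

  vertex : Fin (m + (r * m + r * m)) ↔ Vertex
  vertex = ↔-trans +↔⊎ (↔-trans (↔-refl ⊎-↔ ↔-trans +↔⊎ (*↔× ⊎-↔ *↔×)) ⊎↔Vertex)

  open Inverse vertex using (to; from)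

  _∼_ : Vertex → Vertex → Bool
  hub _     ∼ hub _       = false
  hub _     ∼ inner _ _   = true
  hub l     ∼ outer _ l'  = l == l'
  inner _ _ ∼ hub _       = true
  inner i j ∼ inner i' j' = (i == i') ∧ not (j == j')
  inner i _ ∼ outer i' _  = i == i'
  outer _ l ∼ hub l'      = l == l'
  outer i _ ∼ inner i' _  = i == i'
  outer _ _ ∼ outer _ _   = false

  ∼-sym : ∀ a b → a ∼ b ≡ b ∼ a
  ∼-sym (hub _)     (hub _)       = refl
  ∼-sym (hub _)     (inner _ _)   = refl
  ∼-sym (hub l)     (outer _ l')  = ==-sym l l'
  ∼-sym (inner _ _) (hub _)       = refl
  ∼-sym (inner i j) (inner i' j') rewrite ==-sym i i' | ==-sym j j' = refl
  ∼-sym (inner i _) (outer i' _)  = ==-sym i i'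
  ∼-sym (outer _ l) (hub l')      = ==-sym l l'
  ∼-sym (outer i _) (inner i' _)  = ==-sym i i'
  ∼-sym (outer _ _) (outer _ _)   = refl

  ∼-irrefl : ∀ a → a ∼ a ≡ false
  ∼-irrefl (hub _)     = refl
  ∼-irrefl (inner i j) rewrite ==-refl i | ==-refl j = refl
  ∼-irrefl (outer _ _) = refl

  open GraphOn vertex _∼_ ∼-sym ∼-irrefl

  G : Graph
  G = graph

  isHub : Vertex → Bool
  isHub (hub _) = true
  isHub _       = false

  isSeed : Vertex → Bool
  isSeed (inner _ zero) = true
  isSeed _              = false

  inCopy : Fin r → Vertex → Bool
  inCopy i (hub _)      = false
  inCopy i (inner i' _) = i == i'
  inCopy i (outer i' _) = i == i'

  inCopyOrHub : Fin r → Vertex → Bool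
  inCopyOrHub i a = isHub a ∨ inCopy i a

  isInner : Fin r → Vertex → Bool
  isInner i (inner i' _) = i == i'
  isInner i _            = false

  onSpoke : Fin r → Fin m → Vertex → Bool
  onSpoke i l (hub l')      = l == l'
  onSpoke i l (inner _ _)   = false
  onSpoke i l (outer i' l') = (i == i') ∧ (l == l')

  inBlock : Fin r → Fin m → Vertex → Bool
  inBlock i l a = isInner i a ∨ onSpoke i l a

  inCopy-closed : ∀ i a b → T (inCopy i a) → T (a ∼ b) → ¬ T (isHub b) → T (inCopy i b)
  inCopy-closed i (inner _ _) (hub _)       _  _  ¬hub = contradiction _ ¬hub
  inCopy-closed i (inner i' j) (inner i'' _) i≡ ab _
    with refl ← ==⇒≡ i i' i≡ | refl ← ==⇒≡ i' i'' (proj₁ (Equivalence.to T-∧ ab)) = i≡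
  inCopy-closed i (inner i' _) (outer i'' _) i≡ ab _
    with refl ← ==⇒≡ i i' i≡ | refl ← ==⇒≡ i' i'' ab = i≡
  inCopy-closed i (outer _ _) (hub _)       _  _  ¬hub = contradiction _ ¬hub
  inCopy-closed i (outer i' _) (inner i'' _) i≡ ab _
    with refl ← ==⇒≡ i i' i≡ | refl ← ==⇒≡ i' i'' ab = i≡

  onSpoke-closed : ∀ i l a b → T (onSpoke i l a) → T (a ∼ b) →
                   T (inCopyOrHub i b) → ¬ T (isInner i b) → T (onSpoke i l b)
  onSpoke-closed i l (hub _) (inner _ _)   _  _  i≡ ¬inner = contradiction i≡ ¬inner
  onSpoke-closed i l (hub l') (outer _ l'') l≡ ab i≡ _
    with refl ← ==⇒≡ l l' l≡ | refl ← ==⇒≡ l' l'' ab = Equivalence.from T-∧ (i≡ , l≡)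
  onSpoke-closed i l (outer i' l') (hub l'')    il≡ ab _ _
    with _ , l≡ ← Equivalence.to (T-∧ {i == i'}) il≡ | refl ← ==⇒≡ l' l'' ab = l≡
  onSpoke-closed i l (outer i' l') (inner i'' _) il≡ ab _ ¬inner
    with i≡ , _ ← Equivalence.to (T-∧ {i == i'}) il≡ | refl ← ==⇒≡ i' i'' ab =
    contradiction i≡ ¬inner

  data InBlock (i : Fin r) (l : Fin m) : Vertex → Set where
    hubᴮ   : InBlock i l (hub l)
    outerᴮ : InBlock i l (outer i l)
    innerᴮ : ∀ j → InBlock i l (inner i j)

  InBlock⇒inBlock : ∀ {i l a} → InBlock i l a → T (inBlock i l a)
  InBlock⇒inBlock     hubᴮ       = ≡⇒== refl
  InBlock⇒inBlock {i} outerᴮ     = Equivalence.from (T-∧ {i == i}) (≡⇒== refl , ≡⇒== refl)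
  InBlock⇒inBlock {i} (innerᴮ j) = Equivalence.from (T-∨ {i == i}) (inj₁ (≡⇒== refl))

  inBlock⇒InBlock : ∀ {i l a} → T (inBlock i l a) → InBlock i l a
  inBlock⇒InBlock {i} {l} {hub l'} l≡ with refl ← ==⇒≡ l l' l≡ = hubᴮ
  inBlock⇒InBlock {i} {l} {inner i' j} t with Equivalence.to (T-∨ {i == i'}) t
  ... | inj₁ i≡ with refl ← ==⇒≡ i i' i≡ = innerᴮ j
  inBlock⇒InBlock {i} {l} {outer i' l'} il≡
    with i≡ , l≡ ← Equivalence.to (T-∧ {i == i'}) il≡
    with refl ← ==⇒≡ i i' i≡ | refl ← ==⇒≡ l l' l≡ = outerᴮ

  InBlock-adjacent : ∀ {i l a b} → InBlock i l a → InBlock i l b → a ≢ b → T (a ∼ b)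
  InBlock-adjacent hubᴮ       hubᴮ        a≢b = contradiction refl a≢b
  InBlock-adjacent hubᴮ       outerᴮ      _   = ≡⇒== refl
  InBlock-adjacent hubᴮ       (innerᴮ _)  _   = _
  InBlock-adjacent outerᴮ     hubᴮ        _   = ≡⇒== refl
  InBlock-adjacent outerᴮ     outerᴮ      a≢b = contradiction refl a≢b
  InBlock-adjacent outerᴮ     (innerᴮ _)  _   = ≡⇒== refl
  InBlock-adjacent (innerᴮ _) hubᴮ        _   = _
  InBlock-adjacent (innerᴮ _) outerᴮ      _   = ≡⇒== refl
  InBlock-adjacent {i} (innerᴮ j) (innerᴮ j') a≢b =
    Equivalence.from (T-∧ {i == i})
      (≡⇒== refl , fromWitnessFalse {a? = j ≟ j'} (a≢b ∘ cong (inner i)))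

  seed : Fin r → Vertex
  seed i = inner i zero

  blockMember : Fin r → Fin m → Fin (suc r) → Vertex
  blockMember i l = hub l ∷ outer i l ∷ inner i

  hub-injective : Injective _≡_ _≡_ hub
  hub-injective refl = refl

  inner-injective : ∀ {i} → Injective _≡_ _≡_ (inner i)
  inner-injective refl = refl

  seed-injective : Injective _≡_ _≡_ seed
  seed-injective refl = refl

  blockMember-injective : ∀ {i l} → Injective _≡_ _≡_ (blockMember i l)
  blockMember-injective =
    Injective-∷ (Injective-∷ inner-injective (λ _ ())) λ { zero (); (suc _) () }

  blockMember-InBlock : ∀ i l t → InBlock i l (blockMember i l t)
  blockMember-InBlock i l zero          = hubᴮ
  blockMember-InBlock i l (suc zero)    = outerᴮ
  blockMember-InBlock i l (suc (suc j)) = innerᴮ j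

  InBlock⇒blockMember : ∀ {i l a} → InBlock i l a → ∃ λ t → blockMember i l t ≡ a
  InBlock⇒blockMember hubᴮ       = zero , refl
  InBlock⇒blockMember outerᴮ     = suc zero , refl
  InBlock⇒blockMember (innerᴮ j) = suc (suc j) , refl

  ∣block∣≡1+r : ∀ i l → ∣ ⟦ inBlock i l ⟧ ∣ ≡ suc r
  ∣block∣≡1+r i l = ≤-antisym
    (∣⟦⟧∣≤ (inBlock i l) (blockMember i l) (InBlock⇒blockMember ∘ inBlock⇒InBlock))
    (≤∣⟦⟧∣ (inBlock i l) (blockMember i l) blockMember-injective
           (InBlock⇒inBlock ∘ blockMember-InBlock i l))

  ∣seeds∣≡r : ∣ ⟦ isSeed ⟧ ∣ ≡ r
  ∣seeds∣≡r = ≤-antisym (∣⟦⟧∣≤ isSeed seed λ { {inner i zero} _ → i , refl })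
                        (≤∣⟦⟧∣ isSeed seed seed-injective (λ _ → _))

  ∣hubs∣<r : ∣ ⟦ isHub ⟧ ∣ < r
  ∣hubs∣<r = s≤s (∣⟦⟧∣≤ isHub hub λ { {hub l} _ → l , refl })

  ∣inner∣<r : ∀ i → ∣ ⟦ isInner i ⟧ ∣ < r
  ∣inner∣<r i = s≤s (∣⟦⟧∣≤ (isInner i) (inner i) cover)
    where
    cover : ∀ {a} → T (isInner i a) → ∃ λ j → inner i j ≡ a
    cover {inner i' j} i≡ with refl ← ==⇒≡ i i' i≡ = j , refl

  A : Subset (n G)
  A = ⟦ isSeed ⟧

  seed-infected : ∀ i → from (seed i) ∈ A
  seed-infected i = from-∈⟦⟧ isSeed (seed i) _

  hub-infected : ∀ l → from (hub l) ∈ infected G r A 1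
  hub-infected l = from-∈step (hub l) seed seed-injective (λ _ → _) seed-infected

  inner-infected : ∀ i j → from (inner i j) ∈ infected G r A 2
  inner-infected i zero    = infected-+ G {A = A} 2 0 (seed-infected i)
  inner-infected i (suc j) =
    from-∈step (inner i (suc j)) (seed i ∷ hub) (Injective-∷ hub-injective (λ _ ()))
               adjacent infected-nbr
    where
    adjacent : ∀ t → T (inner i (suc j) ∼ (seed i ∷ hub) t)
    adjacent zero    = Equivalence.from (T-∧ {i == i}) (≡⇒== refl , _)
    adjacent (suc _) = _

    infected-nbr : ∀ t → from ((seed i ∷ hub) t) ∈ infected G r A 1
    infected-nbr zero    = infected-+ G {A = A} 1 0 (seed-infected i)
    infected-nbr (suc l) = hub-infected l

  outer-infected : ∀ i l → from (outer i l) ∈ infected G r A 3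
  outer-infected i l =
    from-∈step (outer i l) (hub l ∷ inner i) (Injective-∷ inner-injective (λ _ ()))
               adjacent infected-nbr
    where
    adjacent : ∀ t → T (outer i l ∼ (hub l ∷ inner i) t)
    adjacent zero    = ≡⇒== refl
    adjacent (suc _) = ≡⇒== refl

    infected-nbr : ∀ t → from ((hub l ∷ inner i) t) ∈ infected G r A 2
    infected-nbr zero    = infected-+ G {A = A} 1 1 (hub-infected l)
    infected-nbr (suc j) = inner-infected i j

  all-infected : ∀ a → from a ∈ infected G r A 3
  all-infected (hub l)     = infected-+ G {A = A} 2 1 (hub-infected l)
  all-infected (inner i j) = infected-+ G {A = A} 1 2 (inner-infected i j)
  all-infected (outer i l) = outer-infected i l

  isBG : BG G r
  isBG = A , ∣seeds∣≡r , all-infected⇒Percolates G 3 (∀-from all-infected)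

  smallCut : HasSmallCut G r
  smallCut =
    ⟦ isHub ⟧ , (⊆⊤ , Separated⇒Disconnected G (off-hubs 0F) (off-hubs 1F) copies-separated) , ∣hubs∣<r
    where
    off-hubs : ∀ i → from (seed i) ∈ ⊤ ─ ⟦ isHub ⟧
    off-hubs i = x∈p∧x∉q⇒x∈p─q ∈⊤ (from-∉⟦⟧ isHub (seed i) λ ())

    copies-separated : Separated G (⊤ ─ ⟦ isHub ⟧) (from (seed 0F)) (from (seed 1F))
    copies-separated =
      ⟦⟧-Separated {⊤} isHub (inCopy 0F) (λ w w' c ww' _ → inCopy-closed 0F (to w) (to w') c ww')
        (from-∈⟦⟧ (inCopy 0F) (seed 0F) _) (from-∉⟦⟧ (inCopy 0F) (seed 1F) λ ())

  InBlock⇒∈⟦inBlock⟧ : ∀ {i l a} → InBlock i l a → from a ∈ ⟦ inBlock i l ⟧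
  InBlock⇒∈⟦inBlock⟧ {i} {l} {a} = from-∈⟦⟧ (inBlock i l) a ∘ InBlock⇒inBlock

  module Block (i : Fin r) (l : Fin m) where

    B : Subset (n G)
    B = ⟦ inBlock i l ⟧

    module _ {S} (B⊆S : B ⊆ S) (κ : KConnected G r S) where

      S⊆copy∪hubs : ∀ {u} → u ∈ S → T (inCopyOrHub i (to u))
      S⊆copy∪hubs {u} u∈S with T? (inCopyOrHub i (to u))
      ... | yes t  = t
      ... | no ¬t with ¬hub , ¬copy ← ¬T-∨ {isHub (to u)} ¬t =
        ⊥-elim (KConnected⇒¬Separated G κ ∣hubs∣<r seed∈ u∈ separated)
        where
        seed∈ : from (seed i) ∈ S ─ ⟦ isHub ⟧
        seed∈ =
          x∈p∧x∉q⇒x∈p─q (B⊆S (InBlock⇒∈⟦inBlock⟧ (innerᴮ zero))) (from-∉⟦⟧ isHub (seed i) λ ())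

        u∈ : u ∈ S ─ ⟦ isHub ⟧
        u∈ = x∈p∧x∉q⇒x∈p─q u∈S (∉⟦⟧ isHub ¬hub)

        separated : Separated G (S ─ ⟦ isHub ⟧) (from (seed i)) u
        separated =
          ⟦⟧-Separated {S} isHub (inCopy i) (λ w w' c ww' _ → inCopy-closed i (to w) (to w') c ww')
            (from-∈⟦⟧ (inCopy i) (seed i) (≡⇒== refl)) (∉⟦⟧ (inCopy i) ¬copy)

      S⊆B : S ⊆ B
      S⊆B {u} u∈S with T? (inBlock i l (to u))
      ... | yes t  = ∈⟦⟧ (inBlock i l) t
      ... | no ¬t with ¬inner , ¬spoke ← ¬T-∨ {isInner i (to u)} ¬t =
        ⊥-elim (KConnected⇒¬Separated G κ (∣inner∣<r i) outer∈ u∈ separated)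
        where
        outer∈ : from (outer i l) ∈ S ─ ⟦ isInner i ⟧
        outer∈ =
          x∈p∧x∉q⇒x∈p─q (B⊆S (InBlock⇒∈⟦inBlock⟧ outerᴮ)) (from-∉⟦⟧ (isInner i) (outer i l) λ ())

        u∈ : u ∈ S ─ ⟦ isInner i ⟧
        u∈ = x∈p∧x∉q⇒x∈p─q u∈S (∉⟦⟧ (isInner i) ¬inner)

        separated : Separated G (S ─ ⟦ isInner i ⟧) (from (outer i l)) u
        separated =
          ⟦⟧-Separated {S} (isInner i) (onSpoke i l)
            (λ w w' p ww' w'∈S → onSpoke-closed i l (to w) (to w') p ww' (S⊆copy∪hubs w'∈S))
            (from-∈⟦⟧ (onSpoke i l) (outer i l) (Equivalence.from (T-∧ {i == i}) (≡⇒== refl , ≡⇒== refl)))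
            (∉⟦⟧ (onSpoke i l) ¬spoke)

    isBlock : IsBlock G r B
    isBlock = maximal⇒IsBlock G (Clique⇒KConnected G clique (≤-reflexive (sym (∣block∣≡1+r i l))))
                                (≤-reflexive (∣block∣≡1+r i l)) (λ _ → S⊆B)
      where
      clique : Clique G B
      clique = ⟦⟧-Clique (λ a b → InBlock-adjacent (inBlock⇒InBlock a) (inBlock⇒InBlock b))

  Block-injective : ∀ {i l i' l'} → Block.B i l ≡ Block.B i' l' → (i , l) ≡ (i' , l')
  Block-injective {i} {l} {i'} {l'} eq =
    outer-InBlock (inBlock⇒InBlock (from-∈⟦⟧⁻ (inBlock i' l') (outer i l) outer∈B'))
    where
    outer-InBlock : InBlock i' l' (outer i l) → (i , l) ≡ (i' , l')
    outer-InBlock outerᴮ = refl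

    outer∈B' : from (outer i l) ∈ Block.B i' l'
    outer∈B' = subst (from (outer i l) ∈_) eq (InBlock⇒∈⟦inBlock⟧ {i} {l} outerᴮ)

  blocks : AtLeastBlocks G r (r * m)
  blocks = uncurry Block.B ∘ Inverse.to *↔× ,
           Injection.injective (↔⇒↣ *↔×) ∘ Block-injective ,
           uncurry Block.isBlock ∘ Inverse.to *↔×

  many-vertices : suc r ≤ n G
  many-vertices = ≤-trans (≤-reflexive (sym (∣block∣≡1+r 0F 0F))) (∣p∣≤n ⟦ inBlock 0F 0F ⟧)

mainTheorem7 : (r : ℕ) → 2 ≤ r →
    Σ Graph λ G → BG G r × suc r ≤ n G × HasSmallCut G r × AtLeastBlocks G r (r * (r ∸ 1))
mainTheorem7 (suc (suc k)) (s≤s (s≤s z≤n)) = G , isBG , many-vertices , smallCut , blocks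
  where open Construction k
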